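{- Let $\bar{x}=[x_1,\dots,x_n]$ be a sequence of integers and $E\subseteq[1,n]$. Let $\mathit{MAX}=\max_k|x_k|$ and let $\bar{y}=\mathit{restr}(\bar{x},E)$ be the sequence obtained from $\bar{x}$ by replacing each $x_i$ with $i\notin E$ by $5\max\{\mathit{MAX},n^2\}+i^2$ (and keeping $y_i=x_i$ for $i\in E$). Then there exist $i,j$ with $\mathrm{MidCond}_{\bar{y}}(i,j)$ if and only if there exist $i,j$ with $\mathrm{MidCond}_{\bar{x}}(i,j)$ and $i,j,\mathit{mid}(i,j)\in E$.
   Context: $\mathit{mid}(a,b)=(a+b)/2$. For a sequence $\bar{z}=[z_1,\dots,z_n]$, $\mathrm{MidCond}_{\bar{z}}(i,j)$ means: $i\neq j$, $j-i$ is even, and $z_{\mathit{mid}(i,j)}=\mathit{mid}(z_i,z_j)$ (indices in $[1,n]$). -}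

module Defs where

open import Data.Nat using (ℕ; suc; _+_; _*_; _⊔_)
open import Data.Integer as ℤ using (ℤ; +_; ∣_∣)
open import Data.Fin using (Fin; toℕ)
open import Data.Fin.Subset using (Subset; _∈_)
open import Data.Fin.Subset.Properties using (_∈?_)
open import Data.Vec.Functional using (Vector; foldr)
open import Data.Product using (Σ; _×_)
open import Relation.Binary.PropositionalEquality using (_≡_; _≢_)
open import Relation.Nullary using (yes; no)

-- A sequence [z_1,...,z_n] is a function Fin n → ℤ; Fin index i stands for
-- the paper's index (toℕ i + 1).

MAX : ∀ {n} → Vector ℤ n → ℕ
MAX x = foldr (λ z m → ∣ z ∣ ⊔ m) 0 x

restr : ∀ {n} → Vector ℤ n → Subset n → Vector ℤ n
restr {n} x E i with i ∈? E
... | yes _ = x i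
... | no  _ = + (5 * (MAX x ⊔ (n * n)) + suc (toℕ i) * suc (toℕ i))

IsMid : ∀ {n} → Fin n → Fin n → Fin n → Set
IsMid i j k = toℕ i + toℕ j ≡ 2 * toℕ k

-- MidCond_z(i,j) with its midpoint index k: i ≠ j, j - i even (witnessed by
-- k with 2k = i + j), and z_k = mid(z_i, z_j), i.e. 2·z_k = z_i + z_j in ℤ.
MidCondAt : ∀ {n} → Vector ℤ n → Fin n → Fin n → Fin n → Set
MidCondAt z i j k = (i ≢ j) × IsMid i j k × (ℤ._*_ (+ 2) (z k) ≡ ℤ._+_ (z i) (z j))

{-# OPTIONS --safe #-}
-- Shift every entry of y = restr(x, E) by B = max{MAX, n²}.  Entries in E then lie in
-- [0, 2B] and entries outside E in (6B, 7B], so a midpoint relation 2y_k = y_i + y_j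
-- cannot mix the two bands: a midpoint in the low band forces its endpoints there, and a
-- midpoint in the high band forces them there too.  Inside the high band the relation
-- reduces to 2(k+1)² = (i+1)² + (j+1)² with (i+1) + (j+1) = 2(k+1), and strict
-- convexity of squaring then gives i = j.
module Submission where

open import Defs
open import Data.Nat using (ℕ; suc; _+_; _*_; _∸_; _⊔_; _≤_; _<_)
open import Data.Nat.Properties
  using (≤-total; +-comm; +-identityʳ; +-cancelˡ-≡; m*n≡0⇒m≡0∨n≡0; m≤n⇒∃[o]m+o≡n
        ; suc-injective; m∸n≤m; m≤m+n; m≤n+m; +-monoˡ-≤; +-monoʳ-≤; +-mono-≤; *-monoˡ-≤
        ; *-monoʳ-≤; *-mono-≤; *-monoʳ-<; ≤-trans; <-irrefl; m≤m⊔n; m≤n⊔m; module ≤-Reasoning)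
open import Data.Nat.Tactic.RingSolver using (solve)
open import Data.Integer as ℤ using (ℤ; +_; -[1+_]; ∣_∣)
import Data.Integer.Properties as ℤ
import Data.Integer.Tactic.RingSolver as ℤ-Solver
open import Data.Fin using (Fin; toℕ)
open import Data.Fin.Properties using (toℕ<n; toℕ-injective)
open import Data.Fin.Subset using (Subset; _∈_; _∉_)
open import Data.Fin.Subset.Properties using (_∈?_)
open import Data.Vec.Functional using (Vector)
open import Data.List.Base using ([]; _∷_)
open import Data.Product using (Σ; ∃-syntax; _×_; _,_; proj₁; proj₂)
open import Data.Sum using (inj₁; inj₂; [_,_]′)
open import Data.Empty using (⊥; ⊥-elim)
open import Function using (id; case_of_)
open import Function.Bundles using (_⇔_; mk⇔)
open import Relation.Nullary using (¬_; yes; no)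
open import Relation.Binary.PropositionalEquality

square-midpoint-gap : ∀ a d c → a + (a + d) ≡ 2 * c →
  a * a + (a + d) * (a + d) ≡ 2 * (c * c) → d ≡ 0
square-midpoint-gap a d c mid sq = [ id , id ]′ (m*n≡0⇒m≡0∨n≡0 d d*d≡0)
  where
  open ≡-Reasoning
  d*d≡0 : d * d ≡ 0
  d*d≡0 = +-cancelˡ-≡ ((a + (a + d)) * (a + (a + d))) (d * d) 0 (begin
    (a + (a + d)) * (a + (a + d)) + d * d ≡⟨ solve (a ∷ d ∷ []) ⟩
    2 * (a * a + (a + d) * (a + d))       ≡⟨ cong (2 *_) sq ⟩
    2 * (2 * (c * c))                     ≡⟨ solve (c ∷ []) ⟩
    (2 * c) * (2 * c)                     ≡⟨ cong (λ t → t * t) (sym mid) ⟩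
    (a + (a + d)) * (a + (a + d))         ≡⟨ sym (+-identityʳ _) ⟩
    (a + (a + d)) * (a + (a + d)) + 0     ∎)

suc-midpoint : ∀ {a b c} → a + b ≡ 2 * c → suc a + suc b ≡ 2 * suc c
suc-midpoint {a} {b} {c} mid = begin
  suc a + suc b   ≡⟨ solve (a ∷ b ∷ []) ⟩
  2 + (a + b)     ≡⟨ cong (_+_ 2) mid ⟩
  2 + 2 * c       ≡⟨ solve (c ∷ []) ⟩
  2 * suc c       ∎
  where open ≡-Reasoning

square-midpoint-injective-≤ : ∀ {a b} c → a ≤ b → a + b ≡ 2 * c →
  a * a + b * b ≡ 2 * (c * c) → a ≡ b
square-midpoint-injective-≤ {a} c a≤b mid sq with (d , refl) ← m≤n⇒∃[o]m+o≡n a≤b =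
  sym (trans (cong (_+_ a) (square-midpoint-gap a d c mid sq)) (+-identityʳ a))

square-midpoint-injective : ∀ a b c → a + b ≡ 2 * c → a * a + b * b ≡ 2 * (c * c) → a ≡ b
square-midpoint-injective a b c mid sq with ≤-total a b
... | inj₁ a≤b = square-midpoint-injective-≤ c a≤b mid sq
... | inj₂ b≤a = sym (square-midpoint-injective-≤ c b≤a
                        (trans (+-comm b a) mid) (trans (+-comm (b * b) (a * a)) sq))

6*B<5*B+suc+B : ∀ B t → 6 * B < 5 * B + suc t + B
6*B<5*B+suc+B B t = begin-strict
  6 * B               <⟨ m≤n+m (suc (6 * B)) t ⟩
  t + suc (6 * B)     ≡⟨ solve (B ∷ t ∷ []) ⟩
  5 * B + suc t + B   ∎
  where open ≤-Reasoning

5*B+s+B≤7*B : ∀ {B s} → s ≤ B → 5 * B + s + B ≤ 7 * B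
5*B+s+B≤7*B {B} {s} s≤B = begin
  5 * B + s + B   ≤⟨ +-monoˡ-≤ B (+-monoʳ-≤ (5 * B) s≤B) ⟩
  5 * B + B + B   ≡⟨ solve (B ∷ []) ⟩
  7 * B           ∎
  where open ≤-Reasoning

band-gap-below : ∀ {a b c} B → 2 * c ≡ a + b → c ≤ 2 * B → ¬ (6 * B < a)
band-gap-below {a} {b} {c} B mid c≤2B 6B<a = <-irrefl refl (begin-strict
  6 * B         <⟨ 6B<a ⟩
  a             ≤⟨ m≤m+n a b ⟩
  a + b         ≡⟨ sym mid ⟩
  2 * c         ≤⟨ *-monoʳ-≤ 2 c≤2B ⟩
  2 * (2 * B)   ≡⟨ solve (B ∷ []) ⟩
  4 * B         ≤⟨ *-monoˡ-≤ B (m≤m+n 4 2) ⟩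
  6 * B         ∎)
  where open ≤-Reasoning

band-gap-above : ∀ {a b c} B → 2 * c ≡ a + b → 6 * B < c → b ≤ 7 * B → ¬ (a ≤ 2 * B)
band-gap-above {a} {b} {c} B mid 6B<c b≤7B a≤2B = <-irrefl refl (begin-strict
  12 * B          ≡⟨ solve (B ∷ []) ⟩
  2 * (6 * B)     <⟨ *-monoʳ-< 2 6B<c ⟩
  2 * c           ≡⟨ mid ⟩
  a + b           ≤⟨ +-mono-≤ a≤2B b≤7B ⟩
  2 * B + 7 * B   ≡⟨ solve (B ∷ []) ⟩
  9 * B           ≤⟨ *-monoˡ-≤ B (m≤m+n 9 3) ⟩
  12 * B          ∎)
  where open ≤-Reasoning

midpoint-cancel : ∀ {a b c} p q → 2 * (p + c + q) ≡ (p + a + q) + (p + b + q) → 2 * c ≡ a + b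
midpoint-cancel {a} {b} {c} p q mid = +-cancelˡ-≡ (2 * (p + q)) _ _ (begin
  2 * (p + q) + 2 * c                  ≡⟨ solve (p ∷ q ∷ c ∷ []) ⟩
  2 * (p + c + q)                      ≡⟨ mid ⟩
  (p + a + q) + (p + b + q)            ≡⟨ solve (p ∷ q ∷ a ∷ b ∷ []) ⟩
  2 * (p + q) + (a + b)                ∎)
  where open ≡-Reasoning

∣∣≤MAX : ∀ {n} (x : Vector ℤ n) (i : Fin n) → ∣ x i ∣ ≤ MAX x
∣∣≤MAX x Fin.zero    = m≤m⊔n _ _
∣∣≤MAX x (Fin.suc i) = ≤-trans (∣∣≤MAX (λ j → x (Fin.suc j)) i) (m≤n⊔m _ _)

shift-bounded : ∀ z B → ∣ z ∣ ≤ B → ∃[ u ] (z ℤ.+ + B ≡ + u × u ≤ 2 * B)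
shift-bounded (+ m)     B m≤B = m + B , refl , +-mono-≤ m≤B (m≤m+n B 0)
shift-bounded -[1+ m ] B m<B =
  B ∸ suc m , ℤ.⊖-≥ m<B , ≤-trans (m∸n≤m B (suc m)) (m≤m+n B (B + 0))

midpoint-translate : ∀ {a b c} t → + 2 ℤ.* c ≡ a ℤ.+ b →
  + 2 ℤ.* (c ℤ.+ t) ≡ (a ℤ.+ t) ℤ.+ (b ℤ.+ t)
midpoint-translate {a} {b} {c} t mid = begin
  + 2 ℤ.* (c ℤ.+ t)            ≡⟨ ℤ-Solver.solve (c ∷ t ∷ []) ⟩
  + 2 ℤ.* c ℤ.+ (t ℤ.+ t)      ≡⟨ cong (ℤ._+ (t ℤ.+ t)) mid ⟩
  (a ℤ.+ b) ℤ.+ (t ℤ.+ t)      ≡⟨ ℤ-Solver.solve (a ∷ b ∷ t ∷ []) ⟩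
  (a ℤ.+ t) ℤ.+ (b ℤ.+ t)      ∎
  where open ≡-Reasoning

MidCondAt-sym : ∀ {n} {z : Vector ℤ n} {i j k} → MidCondAt z i j k → MidCondAt z j i k
MidCondAt-sym {z = z} {i} {j} (i≢j , mid , eq) =
  (λ j≡i → i≢j (sym j≡i)) , trans (+-comm (toℕ j) (toℕ i)) mid , trans eq (ℤ.+-comm (z i) (z j))

MidCondAt-cong : ∀ {n} {y z : Vector ℤ n} {i j k} → y i ≡ z i → y j ≡ z j → y k ≡ z k →
  MidCondAt y i j k → MidCondAt z i j k
MidCondAt-cong yi≡zi yj≡zj yk≡zk (i≢j , mid , eq) =
  i≢j , mid , subst₂ (λ u v → + 2 ℤ.* u ≡ v) yk≡zk (cong₂ ℤ._+_ yi≡zi yj≡zj) eq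

module _ {n : ℕ} (x : Vector ℤ n) (E : Subset n) where

  B : ℕ
  B = MAX x ⊔ n * n

  square : Fin n → ℕ
  square i = suc (toℕ i) * suc (toℕ i)

  square≤B : ∀ i → square i ≤ B
  square≤B i = ≤-trans (*-mono-≤ (toℕ<n i) (toℕ<n i)) (m≤n⊔m (MAX x) (n * n))

  x+B : ∀ i → ∃[ u ] (x i ℤ.+ + B ≡ + u × u ≤ 2 * B)
  x+B i = shift-bounded (x i) B (≤-trans (∣∣≤MAX x i) (m≤m⊔n (MAX x) (n * n)))

  restr-∈ : ∀ {i} → i ∈ E → restr x E i ≡ x i
  restr-∈ {i} i∈E with i ∈? E
  ... | yes _   = refl
  ... | no  i∉E = ⊥-elim (i∉E i∈E)

  height : Fin n → ℕ
  height i with i ∈? E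
  ... | yes _ = proj₁ (x+B i)
  ... | no  _ = 5 * B + square i + B

  restr+B≡height : ∀ i → restr x E i ℤ.+ + B ≡ + height i
  restr+B≡height i with i ∈? E
  ... | yes _ = proj₁ (proj₂ (x+B i))
  ... | no  _ = refl

  height-∈ : ∀ {i} → i ∈ E → height i ≤ 2 * B
  height-∈ {i} i∈E with i ∈? E
  ... | yes _   = proj₂ (proj₂ (x+B i))
  ... | no  i∉E = ⊥-elim (i∉E i∈E)

  height-∉ : ∀ {i} → i ∉ E → height i ≡ 5 * B + square i + B
  height-∉ {i} i∉E with i ∈? E
  ... | yes i∈E = ⊥-elim (i∉E i∈E)
  ... | no  _   = refl

  6B<height-∉ : ∀ {i} → i ∉ E → 6 * B < height i
  6B<height-∉ i∉E rewrite height-∉ i∉E = 6*B<5*B+suc+B B _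

  height≤7B : ∀ i → height i ≤ 7 * B
  height≤7B i = case i ∈? E of λ where
    (yes i∈E) → ≤-trans (height-∈ i∈E) (*-monoˡ-≤ B (m≤m+n 2 5))
    (no  i∉E) → subst (_≤ 7 * B) (sym (height-∉ i∉E)) (5*B+s+B≤7*B (square≤B i))

  midpoint-height : ∀ i j k → MidCondAt (restr x E) i j k →
    2 * height k ≡ height i + height j
  midpoint-height i j k (_ , _ , mid) = ℤ.+-injective (begin
    + (2 * height k)                                       ≡⟨ ℤ.pos-* 2 (height k) ⟩
    + 2 ℤ.* + height k                                     ≡⟨ cong (+ 2 ℤ.*_) (sym (restr+B≡height k)) ⟩
    + 2 ℤ.* (restr x E k ℤ.+ + B)                          ≡⟨ midpoint-translate {restr x E i} {restr x E j} (+ B) mid ⟩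
    (restr x E i ℤ.+ + B) ℤ.+ (restr x E j ℤ.+ + B)        ≡⟨ cong₂ ℤ._+_ (restr+B≡height i) (restr+B≡height j) ⟩
    + height i ℤ.+ + height j                              ∎)
    where open ≡-Reasoning

  midpoint-∈ : ∀ i j k → MidCondAt (restr x E) i j k → k ∈ E → i ∈ E
  midpoint-∈ i j k m k∈E = case i ∈? E of λ where
    (yes i∈E) → i∈E
    (no  i∉E) → ⊥-elim (band-gap-below B (midpoint-height i j k m) (height-∈ k∈E) (6B<height-∉ i∉E))

  midpoint-∉ : ∀ i j k → MidCondAt (restr x E) i j k → k ∉ E → i ∉ E
  midpoint-∉ i j k m k∉E i∈E =
    band-gap-above B (midpoint-height i j k m) (6B<height-∉ k∉E) (height≤7B j) (height-∈ i∈E)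

  no-midpoint-outside : ∀ i j k → MidCondAt (restr x E) i j k →
    i ∉ E → j ∉ E → k ∉ E → ⊥
  no-midpoint-outside i j k m@(i≢j , mid , _) i∉E j∉E k∉E =
    i≢j (toℕ-injective (suc-injective
      (square-midpoint-injective (suc (toℕ i)) (suc (toℕ j)) (suc (toℕ k)) (suc-midpoint mid) squares)))
    where
    open ≡-Reasoning
    squares : square i + square j ≡ 2 * (square k)
    squares = sym (midpoint-cancel (5 * B) B (begin
      2 * (5 * B + square k + B)                        ≡⟨ cong (2 *_) (sym (height-∉ k∉E)) ⟩
      2 * height k                                      ≡⟨ midpoint-height i j k m ⟩
      height i + height j                               ≡⟨ cong₂ _+_ (height-∉ i∉E) (height-∉ j∉E) ⟩
      (5 * B + square i + B) + (5 * B + square j + B)   ∎))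

  restr-midpoint⇒ : ∀ i j k → MidCondAt (restr x E) i j k →
    MidCondAt x i j k × (i ∈ E) × (j ∈ E) × (k ∈ E)
  restr-midpoint⇒ i j k m =
    let m′ = MidCondAt-sym {z = restr x E} {i} {j} {k} m in
    case k ∈? E of λ where
      (yes k∈E) →
        let i∈E = midpoint-∈ i j k m k∈E
            j∈E = midpoint-∈ j i k m′ k∈E
        in MidCondAt-cong (restr-∈ i∈E) (restr-∈ j∈E) (restr-∈ k∈E) m , i∈E , j∈E , k∈E
      (no k∉E) → ⊥-elim (no-midpoint-outside i j k m
        (midpoint-∉ i j k m k∉E) (midpoint-∉ j i k m′ k∉E) k∉E)

  restr-midpoint⇐ : ∀ i j k → MidCondAt x i j k × (i ∈ E) × (j ∈ E) × (k ∈ E) →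
    MidCondAt (restr x E) i j k
  restr-midpoint⇐ i j k (m , i∈E , j∈E , k∈E) =
    MidCondAt-cong (sym (restr-∈ i∈E)) (sym (restr-∈ j∈E)) (sym (restr-∈ k∈E)) m

lemma7 : (n : ℕ) (x : Vector ℤ n) (E : Subset n) →
    (Σ (Fin n) λ i → Σ (Fin n) λ j → Σ (Fin n) λ k → MidCondAt (restr x E) i j k)
    ⇔
    (Σ (Fin n) λ i → Σ (Fin n) λ j → Σ (Fin n) λ k →
      MidCondAt x i j k × (i ∈ E) × (j ∈ E) × (k ∈ E))
lemma7 n x E = mk⇔ (λ (i , j , k , m) → i , j , k , restr-midpoint⇒ x E i j k m)
                   (λ (i , j , k , m) → i , j , k , restr-midpoint⇐ x E i j k m)
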